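{- Let $s,t\ge0$ and $a,b,c,d\ge1$ be integers and consider $H(n)=H(n-s-H(n-a)-H(n-b))+H(n-t-H(n-c)-H(n-d))$. The sequence $\lceil n/4\rceil$ is a solution to $H$ (i.e. $\lceil n/4\rceil=\lceil (n-s-\lceil (n-a)/4\rceil-\lceil (n-b)/4\rceil)/4\rceil+\lceil (n-t-\lceil (n-c)/4\rceil-\lceil (n-d)/4\rceil)/4\rceil$ for all integers $n$) if and only if there is an odd integer $\kappa$ such that: (i) $a+b\in\{4(s+\kappa)-1,\,4(s+\kappa),\,4(s+\kappa)+1\}$; (ii) $c+d\in\{4(t-\kappa)-1,\,4(t-\kappa),\,4(t-\kappa)+1\}$; (iii) $a,b,c,d\not\equiv 0\pmod 4$. -}

module Defs where

open import Data.Integer using (ℤ; +_; -_; _+_; _-_; _*_; _/ℕ_)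

-- ceiling of n/4 for integers n:  ⌈n/4⌉ = - ⌊(-n)/4⌋, where _/ℕ_ is floor division
ceil4 : ℤ → ℤ
ceil4 n = - ((- n) /ℕ 4)

rhs : (s t a b c d n : ℤ) → ℤ
rhs s t a b c d n =
  ceil4 (n - s - ceil4 (n - a) - ceil4 (n - b))
  + ceil4 (n - t - ceil4 (n - c) - ceil4 (n - d))

IsSolution : (s t a b c d : ℤ) → Set
IsSolution s t a b c d = ∀ (n : ℤ) → ceil4 n ≡ rhs s t a b c d n
  where open import Relation.Binary.PropositionalEquality using (_≡_)

module Submission where

-- Write x = 4⌈x/4⌉ − rem4 x with 0 ≤ rem4 x < 4 (division with remainder for
-- the ceiling); representations 4q − r with r < 4 are unique, so ⌈·/4⌉ moves
-- by k and rem4 is unchanged when 4k is added.  Put α, β, γ, δ for the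
-- remainders of a, b, c, d, X = ⌈a/4⌉ + ⌈b/4⌉ − s and Y = ⌈c/4⌉ + ⌈d/4⌉ − t
-- ("offsets") with remainders ξ, η, and K = ⌈X/4⌉ + ⌈Y/4⌉.  Both sides of the
-- corollary depend on the parameters only through (α, β, ξ, γ, δ, η) and K:
--  * solution side: removing multiples of 4 turns the right-hand side of H into
--    a candidate which, like ⌈n/4⌉, grows by 2 along every step of 8; hence
--    ⌈n/4⌉ solves H iff it agrees with the candidate on the window 0, …, 7;
--  * arithmetic side: a + b is within 1 of 4(s + κ) iff κ = X + λ(α + β) and
--    ρ(α + β) ≠ 0, where λ(σ) = ⌈−(σ+2)/4⌉ and ρ(σ) = rem4 (−(σ+2)); the
--    parity of κ, the coupling of κ between (i) and (ii) and 4 ∤ a are also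
--    conditions on the remainders and K.
-- Each side forces the value of K, so the remaining equivalence concerns only
-- the 4⁶ tuples of remainders and is decided by evaluation.  The theorem is the
-- composite of the three equivalences.

open import Defs
open import Data.Integer using (ℤ; +_; _+_; _-_; _*_; _≤_)
open import Data.Integer.Divisibility using (_∣_)
open import Data.Product using (Σ; _×_)
open import Data.Sum using (_⊎_)
open import Relation.Nullary using (¬_)
open import Relation.Binary.PropositionalEquality using (_≡_)
open import Function.Bundles using (_⇔_)

open import Data.Integer using (-_; -[1+_]; _/ℕ_; _%ℕ_; _≟_; ∣_∣)
open import Data.Integer.Divisibility using (divides)
import Data.Integer.Properties as ℤ
open import Data.Integer.DivMod using (a≡a%ℕn+[a/ℕn]*n; n%ℕd<d)
open import Data.Integer.Tactic.RingSolver using (solve-∀)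
import Data.Nat as ℕ
open ℕ using (ℕ; zero; suc; z≤n; s≤s)
import Data.Nat.Properties as ℕₚ
open import Data.Product using (_,_; proj₁; proj₂)
open import Data.Sum using (inj₁; inj₂)
open import Data.Empty using (⊥-elim)
open import Data.Unit using (tt)
open import Function.Bundles using (mk⇔; Equivalence)
open import Function.Properties.Equivalence using () renaming (trans to ⇔-trans; sym to ⇔-sym)
open import Relation.Nullary using (Dec; ¬?)
open import Relation.Nullary.Decidable using (_×-dec_; _→-dec_; toWitness)
open import Relation.Binary.PropositionalEquality
  using (_≢_; refl; sym; trans; cong; cong₂; subst; subst₂; module ≡-Reasoning)

open Equivalence using (to; from)

-- A linear consequence of one equation: u ≡ w follows from x ≡ y once
-- u = (y − x) + w holds identically (the identity is left to the ring solver).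
by-difference : ∀ {u w x y} → u ≡ (y - x) + w → x ≡ y → u ≡ w
by-difference {w = w} {y = y} u≡ refl =
  trans u≡ (trans (cong (_+ w) (ℤ.+-inverseʳ y)) (ℤ.+-identityˡ w))

-- Arithmetic of the ceiling ⌈x/4⌉

-- The remainder in x = 4⌈x/4⌉ − rem4 x; it lies below 4 and the
-- decomposition itself is ceil4-rem4.
rem4 : ℤ → ℕ
rem4 x = (- x) %ℕ 4

rem4<4 : ∀ x → rem4 x ℕ.< 4
rem4<4 x = n%ℕd<d (- x) 4

ceil4-rem4 : ∀ x → x ≡ + 4 * ceil4 x - + rem4 x
ceil4-rem4 x = begin
  x                                   ≡⟨ ℤ.neg-involutive x ⟨
  - (- x)                             ≡⟨ cong -_ (a≡a%ℕn+[a/ℕn]*n (- x) 4) ⟩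
  - (+ rem4 x + ((- x) /ℕ 4) * + 4)   ≡⟨ negate (+ rem4 x) ((- x) /ℕ 4) ⟩
  + 4 * ceil4 x - + rem4 x            ∎
  where
  open ≡-Reasoning
  negate : ∀ r q → - (r + q * + 4) ≡ + 4 * (- q) - r
  negate = solve-∀

not-four-apart : ∀ {r r'} k → r ℕ.< 4 → r ≢ r' ℕ.+ 4 ℕ.* suc k
not-four-apart {r} {r'} k r<4 r≡ = ℕₚ.<⇒≱ r<4
  (subst (4 ℕ.≤_) (sym r≡) (ℕₚ.≤-trans (ℕₚ.m≤m*n 4 (suc k)) (ℕₚ.m≤n+m _ r')))

remainder-gap : ∀ {r r'} d → r ℕ.< 4 → r' ℕ.< 4 → + r ≡ + r' + + 4 * d → d ≡ + 0
remainder-gap (+ zero)  _   _    _   = refl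
remainder-gap (+ suc k) r<4 _    gap = ⊥-elim (not-four-apart k r<4 (ℤ.+-injective gap))
remainder-gap {r} {r'} -[1+ k ] _ r'<4 gap =
  ⊥-elim (not-four-apart k r'<4 (ℤ.+-injective (by-difference (flip (+ r) (+ r') -[1+ k ]) gap)))
  where
  flip : ∀ x y d → y ≡ ((y + + 4 * d) - x) + (x + + 4 * (- d))
  flip = solve-∀

representation-unique : ∀ {q q' r r'} → r ℕ.< 4 → r' ℕ.< 4 →
  + 4 * q - + r ≡ + 4 * q' - + r' → q ≡ q' × r ≡ r'
representation-unique {q} {q'} {r} {r'} r<4 r'<4 eq =
  ℤ.i-j≡0⇒i≡j q q' q-q'≡0 ,
  ℤ.+-injective (trans gap (trans (cong (λ e → + r' + + 4 * e) q-q'≡0) (ℤ.+-identityʳ (+ r'))))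
  where
  regroup : ∀ q q' r r' → r ≡ ((+ 4 * q' - r') - (+ 4 * q - r)) + (r' + + 4 * (q - q'))
  regroup = solve-∀
  gap : + r ≡ + r' + + 4 * (q - q')
  gap = by-difference (regroup q q' (+ r) (+ r')) eq
  q-q'≡0 : q - q' ≡ + 0
  q-q'≡0 = remainder-gap (q - q') r<4 r'<4 gap

ceil4-unique : ∀ {x q r} → r ℕ.< 4 → x ≡ + 4 * q - + r → ceil4 x ≡ q × rem4 x ≡ r
ceil4-unique {x} r<4 eq = representation-unique (rem4<4 x) r<4 (trans (sym (ceil4-rem4 x)) eq)

ceil4-exact : ∀ q → ceil4 (+ 4 * q) ≡ q
ceil4-exact q = proj₁ (ceil4-unique (s≤s z≤n) (sym (ℤ.+-identityʳ (+ 4 * q))))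

ceil4-shift : ∀ x k → ceil4 (x + + 4 * k) ≡ ceil4 x + k × rem4 (x + + 4 * k) ≡ rem4 x
ceil4-shift x k = ceil4-unique (rem4<4 x) (begin
  x + + 4 * k                          ≡⟨ cong (_+ + 4 * k) (ceil4-rem4 x) ⟩
  + 4 * ceil4 x - + rem4 x + + 4 * k   ≡⟨ regroup (ceil4 x) (+ rem4 x) k ⟩
  + 4 * (ceil4 x + k) - + rem4 x       ∎)
  where
  open ≡-Reasoning
  regroup : ∀ q r k → + 4 * q - r + + 4 * k ≡ + 4 * (q + k) - r
  regroup = solve-∀

ceil4-period : ∀ x k → ceil4 (x + + 8 * k) ≡ ceil4 x + + 2 * k
ceil4-period x k = trans (cong ceil4 (eight x k)) (proj₁ (ceil4-shift x (+ 2 * k)))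
  where
  eight : ∀ x k → x + + 8 * k ≡ x + + 4 * (+ 2 * k)
  eight = solve-∀

-- ⌈(n − a)/4⌉ = ⌈(n + rem4 a)/4⌉ − ⌈a/4⌉: only the remainder of a enters
-- the inner ceilings of H, its quotient is pulled out.
ceil4-difference : ∀ n a → ceil4 (n - a) ≡ ceil4 (n + + rem4 a) - ceil4 a
ceil4-difference n a = trans (cong ceil4 split) (proj₁ (ceil4-shift (n + + rem4 a) (- ceil4 a)))
  where
  regroup : ∀ n q r → n - (+ 4 * q - r) ≡ (n + r) + + 4 * (- q)
  regroup = solve-∀
  split : n - a ≡ (n + + rem4 a) + + 4 * (- ceil4 a)
  split = trans (cong (λ z → n - z) (ceil4-rem4 a)) (regroup n (ceil4 a) (+ rem4 a))

-- The solution side: reduction to a window of eight values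

-- One summand of H after all multiples of 4 have been removed from its
-- parameters; α, β are the remainders of a, b and ξ that of the offset.
reduced : (α β ξ : ℕ) → ℤ → ℤ
reduced α β ξ n = ceil4 (n - ceil4 (n + + α) - ceil4 (n + + β) - + ξ)

offset : (s a b : ℤ) → ℤ
offset s a b = ceil4 a + ceil4 b - s

-- One summand of H is its reduced version shifted by ⌈X/4⌉: the quotients of
-- a and b are pulled out of the inner ceilings and X = 4⌈X/4⌉ − ξ.
summand-reduction : ∀ s a b n →
  ceil4 (n - s - ceil4 (n - a) - ceil4 (n - b))
    ≡ reduced (rem4 a) (rem4 b) (rem4 (offset s a b)) n + ceil4 (offset s a b)
summand-reduction s a b n = begin
    ceil4 (n - s - ceil4 (n - a) - ceil4 (n - b))
  ≡⟨ cong₂ (λ u v → ceil4 (n - s - u - v)) (ceil4-difference n a) (ceil4-difference n b) ⟩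
    ceil4 (n - s - (gα - ceil4 a) - (gβ - ceil4 b))
  ≡⟨ cong ceil4 (collect n s gα gβ (ceil4 a) (ceil4 b)) ⟩
    ceil4 (core + X)
  ≡⟨ cong (λ z → ceil4 (core + z)) (ceil4-rem4 X) ⟩
    ceil4 (core + (+ 4 * ceil4 X - + rem4 X))
  ≡⟨ cong ceil4 (separate core (ceil4 X) (+ rem4 X)) ⟩
    ceil4 (core - + rem4 X + + 4 * ceil4 X)
  ≡⟨ proj₁ (ceil4-shift (core - + rem4 X) (ceil4 X)) ⟩
    reduced (rem4 a) (rem4 b) (rem4 X) n + ceil4 X
  ∎
  where
  open ≡-Reasoning
  X gα gβ core : ℤ
  X = offset s a b
  gα = ceil4 (n + + rem4 a)
  gβ = ceil4 (n + + rem4 b)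
  core = n - gα - gβ
  collect : ∀ n s u v A B → n - s - (u - A) - (v - B) ≡ n - u - v + (A + B - s)
  collect = solve-∀
  separate : ∀ c P ξ → c + (+ 4 * P - ξ) ≡ c - ξ + + 4 * P
  separate = solve-∀

reduced-period : ∀ α β ξ n k → reduced α β ξ (n + + 8 * k) ≡ reduced α β ξ n + k
reduced-period α β ξ n k = begin
    reduced α β ξ (n + + 8 * k)
  ≡⟨ cong₂ (λ u v → ceil4 (n + + 8 * k - u - v - + ξ)) (moved α) (moved β) ⟩
    ceil4 (n + + 8 * k - (gα + + 2 * k) - (gβ + + 2 * k) - + ξ)
  ≡⟨ cong ceil4 (regroup n k gα gβ (+ ξ)) ⟩
    ceil4 (n - gα - gβ - + ξ + + 4 * k)
  ≡⟨ proj₁ (ceil4-shift (n - gα - gβ - + ξ) k) ⟩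
    reduced α β ξ n + k
  ∎
  where
  open ≡-Reasoning
  gα gβ : ℤ
  gα = ceil4 (n + + α)
  gβ = ceil4 (n + + β)
  swap : ∀ n k c → n + + 8 * k + c ≡ n + c + + 8 * k
  swap = solve-∀
  moved : ∀ c → ceil4 (n + + 8 * k + + c) ≡ ceil4 (n + + c) + + 2 * k
  moved c = trans (cong ceil4 (swap n k (+ c))) (ceil4-period (n + + c) k)
  regroup : ∀ n k u v ξ → n + + 8 * k - (u + + 2 * k) - (v + + 2 * k) - ξ ≡ n - u - v - ξ + + 4 * k
  regroup = solve-∀

candidate : (α β ξ γ δ η : ℕ) → ℤ → ℤ → ℤ
candidate α β ξ γ δ η K n = reduced α β ξ n + reduced γ δ η n + K

candidate-period : ∀ α β ξ γ δ η K n k →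
  candidate α β ξ γ δ η K (n + + 8 * k) ≡ candidate α β ξ γ δ η K n + + 2 * k
candidate-period α β ξ γ δ η K n k =
  trans (cong₂ (λ u v → u + v + K) (reduced-period α β ξ n k) (reduced-period γ δ η n k))
        (regroup (reduced α β ξ n) (reduced γ δ η n) K k)
  where
  regroup : ∀ x y K k → x + k + (y + k) + K ≡ x + y + K + + 2 * k
  regroup = solve-∀

rhs-reduction : ∀ s t a b c d n → rhs s t a b c d n ≡
  candidate (rem4 a) (rem4 b) (rem4 (offset s a b)) (rem4 c) (rem4 d) (rem4 (offset t c d))
            (ceil4 (offset s a b) + ceil4 (offset t c d)) n
rhs-reduction s t a b c d n =
  trans (cong₂ _+_ (summand-reduction s a b n) (summand-reduction t c d n))
        (regroup (reduced (rem4 a) (rem4 b) (rem4 (offset s a b)) n)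
                 (reduced (rem4 c) (rem4 d) (rem4 (offset t c d)) n)
                 (ceil4 (offset s a b)) (ceil4 (offset t c d)))
  where
  regroup : ∀ x y P Q → x + P + (y + Q) ≡ x + y + (P + Q)
  regroup = solve-∀

agree-on-window : (F : ℤ → ℤ) → (∀ n k → F (n + + 8 * k) ≡ F n + + 2 * k) →
  (∀ {m} → m ℕ.< 8 → ceil4 (+ m) ≡ F (+ m)) → ∀ n → ceil4 n ≡ F n
agree-on-window F F-period agree n = begin
  ceil4 n                  ≡⟨ cong ceil4 split ⟩
  ceil4 (+ m + + 8 * k)    ≡⟨ ceil4-period (+ m) k ⟩
  ceil4 (+ m) + + 2 * k    ≡⟨ cong (_+ + 2 * k) (agree (n%ℕd<d n 8)) ⟩
  F (+ m) + + 2 * k        ≡⟨ F-period (+ m) k ⟨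
  F (+ m + + 8 * k)        ≡⟨ cong F split ⟨
  F n                      ∎
  where
  open ≡-Reasoning
  m : ℕ
  m = n %ℕ 8
  k : ℤ
  k = n /ℕ 8
  split : n ≡ + m + + 8 * k
  split = trans (a≡a%ℕn+[a/ℕn]*n n 8) (cong (λ z → + m + z) (ℤ.*-comm k (+ 8)))

Window : (α β ξ γ δ η : ℕ) → ℤ → Set
Window α β ξ γ δ η K = ∀ {m} → m ℕ.< 8 → ceil4 (+ m) ≡ candidate α β ξ γ δ η K (+ m)

solution⇔window : ∀ s t a b c d → IsSolution s t a b c d ⇔
  Window (rem4 a) (rem4 b) (rem4 (offset s a b)) (rem4 c) (rem4 d) (rem4 (offset t c d))
         (ceil4 (offset s a b) + ceil4 (offset t c d))
solution⇔window s t a b c d = mk⇔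
  (λ solution {m} _ → trans (solution (+ m)) (rhs-reduction s t a b c d (+ m)))
  (λ window n → trans (agree-on-window (candidate α β ξ γ δ η K) (candidate-period α β ξ γ δ η K) window n)
                      (sym (rhs-reduction s t a b c d n)))
  where
  α β ξ γ δ η : ℕ
  α = rem4 a
  β = rem4 b
  ξ = rem4 (offset s a b)
  γ = rem4 c
  δ = rem4 d
  η = rem4 (offset t c d)
  K : ℤ
  K = ceil4 (offset s a b) + ceil4 (offset t c d)

-- The arithmetic side: conditions (i)–(iii) in terms of remainders

Near : ℤ → ℤ → Set
Near x y = (x ≡ y - + 1) ⊎ (x ≡ y) ⊎ (x ≡ y + + 1)

-- x is within 1 of 4κ exactly when x − 2 = 4κ − r with r ∈ {1, 2, 3}.
near-multiple-of-four : ∀ x κ → Near x (+ 4 * κ) ⇔ (κ ≡ ceil4 (x - + 2) × rem4 (x - + 2) ≢ 0)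
near-multiple-of-four x κ = mk⇔ forward backward
  where
  represented : ∀ {r} → r ℕ.< 4 → r ≢ 0 → x - + 2 ≡ + 4 * κ - + r →
                κ ≡ ceil4 (x - + 2) × rem4 (x - + 2) ≢ 0
  represented r<4 r≢0 eq =
    let (ceil≡ , rem≡) = ceil4-unique r<4 eq
    in sym ceil≡ , λ rem≡0 → r≢0 (trans (sym rem≡) rem≡0)

  forward : Near x (+ 4 * κ) → κ ≡ ceil4 (x - + 2) × rem4 (x - + 2) ≢ 0
  forward (inj₁ x≡)        = represented {3} (s≤s (s≤s (s≤s (s≤s z≤n)))) (λ ())
    (trans (cong (_- + 2) x≡) (ℤ.+-assoc (+ 4 * κ) (- + 1) (- + 2)))
  forward (inj₂ (inj₁ x≡)) = represented {2} (s≤s (s≤s (s≤s z≤n))) (λ ()) (cong (_- + 2) x≡)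
  forward (inj₂ (inj₂ x≡)) = represented {1} (s≤s (s≤s z≤n)) (λ ())
    (trans (cong (_- + 2) x≡) (ℤ.+-assoc (+ 4 * κ) (+ 1) (- + 2)))

  restore : ∀ r → x - + 2 ≡ + 4 * κ - + r → x ≡ + 4 * κ - + r + + 2
  restore r eq = trans (sym (trans (ℤ.+-assoc x (- + 2) (+ 2)) (ℤ.+-identityʳ x))) (cong (_+ + 2) eq)

  near-from : ∀ r → r ℕ.< 4 → r ≢ 0 → x - + 2 ≡ + 4 * κ - + r → Near x (+ 4 * κ)
  near-from 0 _ r≢0 _ = ⊥-elim (r≢0 refl)
  near-from 1 _ _ eq = inj₂ (inj₂ (trans (restore 1 eq) (ℤ.+-assoc (+ 4 * κ) (- + 1) (+ 2))))
  near-from 2 _ _ eq = inj₂ (inj₁ (trans (restore 2 eq)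
    (trans (ℤ.+-assoc (+ 4 * κ) (- + 2) (+ 2)) (ℤ.+-identityʳ (+ 4 * κ)))))
  near-from 3 _ _ eq = inj₁ (trans (restore 3 eq) (ℤ.+-assoc (+ 4 * κ) (- + 3) (+ 2)))
  near-from (suc (suc (suc (suc _)))) (s≤s (s≤s (s≤s (s≤s ())))) _ _

  backward : κ ≡ ceil4 (x - + 2) × rem4 (x - + 2) ≢ 0 → Near x (+ 4 * κ)
  backward (κ≡ , rem≢0) = near-from (rem4 (x - + 2)) (rem4<4 (x - + 2)) rem≢0
    (trans (ceil4-rem4 (x - + 2)) (cong (λ q → + 4 * q - + rem4 (x - + 2)) (sym κ≡)))

-- For a pair with remainder sum σ: the ceiling λ(σ) and the remainder ρ(σ)
-- of −(σ + 2), the quantities through which condition (i) sees the pair.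
lift : ℕ → ℤ
lift σ = ceil4 (- + (σ ℕ.+ 2))

slack : ℕ → ℕ
slack σ = rem4 (- + (σ ℕ.+ 2))

pair-condition : ∀ s a b κ → Near (a + b) (+ 4 * (s + κ)) ⇔
  (κ ≡ offset s a b + lift (rem4 a ℕ.+ rem4 b) × slack (rem4 a ℕ.+ rem4 b) ≢ 0)
pair-condition s a b κ = mk⇔
  (λ near → let (κ≡ , rem≢0) = to (near-multiple-of-four (a + b) (s + κ)) near
            in cancel (trans κ≡ ceil≡) , subst (_≢ 0) rem≡ rem≢0)
  (λ (κ≡ , slack≢0) → from (near-multiple-of-four (a + b) (s + κ))
            (trans (uncancel κ≡) (sym ceil≡) , subst (_≢ 0) (sym rem≡) slack≢0))
  where
  σ : ℕ
  σ = rem4 a ℕ.+ rem4 b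
  X : ℤ
  X = offset s a b
  expand : ∀ A B α β s → (+ 4 * A - α) + (+ 4 * B - β) - + 2 ≡ - (α + β + + 2) + + 4 * (s + (A + B - s))
  expand = solve-∀
  split : a + b - + 2 ≡ - + (σ ℕ.+ 2) + + 4 * (s + X)
  split = trans (cong₂ (λ u v → u + v - + 2) (ceil4-rem4 a) (ceil4-rem4 b))
                (expand (ceil4 a) (ceil4 b) (+ rem4 a) (+ rem4 b) s)
  ceil≡ : ceil4 (a + b - + 2) ≡ lift σ + (s + X)
  ceil≡ = trans (cong ceil4 split) (proj₁ (ceil4-shift (- + (σ ℕ.+ 2)) (s + X)))
  rem≡ : rem4 (a + b - + 2) ≡ slack σ
  rem≡ = trans (cong rem4 split) (proj₂ (ceil4-shift (- + (σ ℕ.+ 2)) (s + X)))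
  cancel-identity : ∀ s κ X l → κ ≡ ((s + κ) - (l + (s + X))) + (X + l)
  cancel-identity = solve-∀
  cancel : s + κ ≡ lift σ + (s + X) → κ ≡ X + lift σ
  cancel eq = by-difference (cancel-identity s κ X (lift σ)) (sym eq)
  uncancel-identity : ∀ s X l → s + (X + l) ≡ l + (s + X)
  uncancel-identity = solve-∀
  uncancel : κ ≡ X + lift σ → s + κ ≡ lift σ + (s + X)
  uncancel refl = uncancel-identity s X (lift σ)

Odd : ℤ → Set
Odd κ = Σ ℤ λ m → κ ≡ + 2 * m + + 1

odd⇔rem4 : ∀ κ → Odd κ ⇔ rem4 (+ 2 * κ) ≡ 2
odd⇔rem4 κ = mk⇔
  (λ (m , κ≡) → proj₂ (ceil4-unique {q = m + + 1} (s≤s (s≤s (s≤s z≤n)))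
                  (trans (cong (+ 2 *_) κ≡) (double-odd m))))
  (λ rem≡2 → ceil4 (+ 2 * κ) - + 1 , ℤ.*-cancelˡ-≡ (+ 2) κ _
                  (trans (subst (λ r → + 2 * κ ≡ + 4 * ceil4 (+ 2 * κ) - + r) rem≡2 (ceil4-rem4 (+ 2 * κ)))
                         (halve (ceil4 (+ 2 * κ)))))
  where
  double-odd : ∀ m → + 2 * (+ 2 * m + + 1) ≡ + 4 * (m + + 1) - + 2
  double-odd = solve-∀
  halve : ∀ q → + 4 * q - + 2 ≡ + 2 * (+ 2 * (q - + 1) + + 1)
  halve = solve-∀

parity-shift : ∀ X l → rem4 (+ 2 * (X + l)) ≡ rem4 (+ 2 * (l - + rem4 X))
parity-shift X l = trans (cong rem4 split) (proj₂ (ceil4-shift (+ 2 * (l - + rem4 X)) (+ 2 * ceil4 X)))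
  where
  regroup : ∀ P ξ l → + 2 * ((+ 4 * P - ξ) + l) ≡ + 2 * (l - ξ) + + 4 * (+ 2 * P)
  regroup = solve-∀
  split : + 2 * (X + l) ≡ + 2 * (l - + rem4 X) + + 4 * (+ 2 * ceil4 X)
  split = trans (cong (λ z → + 2 * (z + l)) (ceil4-rem4 X)) (regroup (ceil4 X) (+ rem4 X) l)

balance : ∀ X Y l₁ l₂ → - (X + l₁) ≡ Y + l₂ ⇔
  + 4 * (ceil4 X + ceil4 Y) ≡ + rem4 X + + rem4 Y - l₁ - l₂
balance X Y l₁ l₂ = mk⇔
  (λ eq → by-difference (forward-identity P Q ξ η l₁ l₂) (subst₂ (λ x y → - (x + l₁) ≡ y + l₂) X≡ Y≡ eq))
  (λ eq → subst₂ (λ x y → - (x + l₁) ≡ y + l₂) (sym X≡) (sym Y≡)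
            (by-difference (backward-identity P Q ξ η l₁ l₂) eq))
  where
  P Q ξ η : ℤ
  P = ceil4 X
  Q = ceil4 Y
  ξ = + rem4 X
  η = + rem4 Y
  X≡ : X ≡ + 4 * P - ξ
  X≡ = ceil4-rem4 X
  Y≡ : Y ≡ + 4 * Q - η
  Y≡ = ceil4-rem4 Y
  forward-identity : ∀ P Q ξ η l₁ l₂ → + 4 * (P + Q) ≡
    (((+ 4 * Q - η) + l₂) - - ((+ 4 * P - ξ) + l₁)) + (ξ + η - l₁ - l₂)
  forward-identity = solve-∀
  backward-identity : ∀ P Q ξ η l₁ l₂ → - ((+ 4 * P - ξ) + l₁) ≡
    ((ξ + η - l₁ - l₂) - + 4 * (P + Q)) + ((+ 4 * Q - η) + l₂)
  backward-identity = solve-∀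

four-divides⇔ : ∀ x → + 4 ∣ x ⇔ rem4 x ≡ 0
four-divides⇔ x = mk⇔ forward backward
  where
  open ≡-Reasoning
  multiple : ∀ q → x ≡ + 4 * q → rem4 x ≡ 0
  multiple q eq = proj₂ (ceil4-unique {q = q} (s≤s z≤n) (trans eq (sym (ℤ.+-identityʳ (+ 4 * q)))))
  four-k : ∀ k → + (k ℕ.* 4) ≡ + 4 * + k
  four-k k = trans (ℤ.pos-* k 4) (ℤ.*-comm (+ k) (+ 4))
  forward : + 4 ∣ x → rem4 x ≡ 0
  forward (divides k eq) with ℤ.+∣i∣≡i⊎+∣i∣≡-i x
  ... | inj₁ abs≡ = multiple (+ k) (trans (sym abs≡) (trans (cong +_ eq) (four-k k)))
  ... | inj₂ abs≡ = multiple (- + k) (begin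
    x                  ≡⟨ ℤ.neg-involutive x ⟨
    - (- x)            ≡⟨ cong -_ abs≡ ⟨
    - (+ ∣ x ∣)        ≡⟨ cong (λ z → - (+ z)) eq ⟩
    - (+ (k ℕ.* 4))    ≡⟨ cong -_ (four-k k) ⟩
    - (+ 4 * + k)      ≡⟨ ℤ.neg-distribʳ-* (+ 4) (+ k) ⟩
    + 4 * - + k        ∎)
  backward : rem4 x ≡ 0 → + 4 ∣ x
  backward rem≡0 = divides ∣ ceil4 x ∣
    (trans (cong ∣_∣ x≡) (trans (ℤ.abs-* (+ 4) (ceil4 x)) (ℕₚ.*-comm 4 ∣ ceil4 x ∣)))
    where
    x≡ : x ≡ + 4 * ceil4 x
    x≡ = trans (subst (λ r → x ≡ + 4 * ceil4 x - + r) rem≡0 (ceil4-rem4 x)) (ℤ.+-identityʳ (+ 4 * ceil4 x))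

not-four-divides⇔ : ∀ x → (¬ + 4 ∣ x) ⇔ rem4 x ≢ 0
not-four-divides⇔ x = mk⇔ (λ ∤x rem≡0 → ∤x (from (four-divides⇔ x) rem≡0))
                          (λ rem≢0 ∣x → rem≢0 (to (four-divides⇔ x) ∣x))

Goal : (s t a b c d : ℤ) → Set
Goal s t a b c d = Σ ℤ λ κ → Odd κ × Near (a + b) (+ 4 * (s + κ)) × Near (c + d) (+ 4 * (t - κ))
  × ¬ (+ 4 ∣ a) × ¬ (+ 4 ∣ b) × ¬ (+ 4 ∣ c) × ¬ (+ 4 ∣ d)

Conditions : (α β ξ γ δ η : ℕ) → ℤ → Set
Conditions α β ξ γ δ η K =
    α ≢ 0 × β ≢ 0 × γ ≢ 0 × δ ≢ 0
  × slack (α ℕ.+ β) ≢ 0 × slack (γ ℕ.+ δ) ≢ 0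
  × rem4 (+ 2 * (lift (α ℕ.+ β) - + ξ)) ≡ 2
  × + 4 * K ≡ + ξ + + η - lift (α ℕ.+ β) - lift (γ ℕ.+ δ)

-- κ is forced to be X + λ₁ by (i); (ii) then says −κ = Y + λ₂, which is the
-- balance equation for K, and the parity of κ is that of λ₁ − rem4 X.
goal⇔conditions : ∀ s t a b c d → Goal s t a b c d ⇔
  Conditions (rem4 a) (rem4 b) (rem4 (offset s a b)) (rem4 c) (rem4 d) (rem4 (offset t c d))
             (ceil4 (offset s a b) + ceil4 (offset t c d))
goal⇔conditions s t a b c d = mk⇔ forward backward
  where
  X Y l₁ l₂ : ℤ
  X = offset s a b
  Y = offset t c d
  l₁ = lift (rem4 a ℕ.+ rem4 b)
  l₂ = lift (rem4 c ℕ.+ rem4 d)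

  forward : Goal s t a b c d → Conditions (rem4 a) (rem4 b) (rem4 X) (rem4 c) (rem4 d) (rem4 Y) (ceil4 X + ceil4 Y)
  forward (κ , odd , near₁ , near₂ , ∤a , ∤b , ∤c , ∤d) =
    to (not-four-divides⇔ a) ∤a , to (not-four-divides⇔ b) ∤b ,
    to (not-four-divides⇔ c) ∤c , to (not-four-divides⇔ d) ∤d ,
    proj₂ first , proj₂ second ,
    trans (sym (parity-shift X l₁)) (subst (λ k → rem4 (+ 2 * k) ≡ 2) (proj₁ first) (to (odd⇔rem4 κ) odd)) ,
    to (balance X Y l₁ l₂) (subst (λ k → - k ≡ Y + l₂) (proj₁ first) (proj₁ second))
    where
    first : κ ≡ X + l₁ × slack (rem4 a ℕ.+ rem4 b) ≢ 0
    first = to (pair-condition s a b κ) near₁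
    second : - κ ≡ Y + l₂ × slack (rem4 c ℕ.+ rem4 d) ≢ 0
    second = to (pair-condition t c d (- κ)) near₂

  backward : Conditions (rem4 a) (rem4 b) (rem4 X) (rem4 c) (rem4 d) (rem4 Y) (ceil4 X + ceil4 Y) → Goal s t a b c d
  backward (α≢0 , β≢0 , γ≢0 , δ≢0 , slack₁≢0 , slack₂≢0 , parity , balanced) =
    X + l₁ ,
    from (odd⇔rem4 (X + l₁)) (trans (parity-shift X l₁) parity) ,
    from (pair-condition s a b (X + l₁)) (refl , slack₁≢0) ,
    from (pair-condition t c d (- (X + l₁))) (from (balance X Y l₁ l₂) balanced , slack₂≢0) ,
    from (not-four-divides⇔ a) α≢0 , from (not-four-divides⇔ b) β≢0 ,
    from (not-four-divides⇔ c) γ≢0 , from (not-four-divides⇔ d) δ≢0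

window? : ∀ α β ξ γ δ η K → Dec (Window α β ξ γ δ η K)
window? α β ξ γ δ η K = ℕₚ.allUpTo? (λ m → ceil4 (+ m) ≟ candidate α β ξ γ δ η K (+ m)) 8

conditions? : ∀ α β ξ γ δ η K → Dec (Conditions α β ξ γ δ η K)
conditions? α β ξ γ δ η K =
  ¬? (α ℕ.≟ 0) ×-dec ¬? (β ℕ.≟ 0) ×-dec ¬? (γ ℕ.≟ 0) ×-dec ¬? (δ ℕ.≟ 0)
  ×-dec ¬? (slack (α ℕ.+ β) ℕ.≟ 0) ×-dec ¬? (slack (γ ℕ.+ δ) ℕ.≟ 0)
  ×-dec rem4 (+ 2 * (lift (α ℕ.+ β) - + ξ)) ℕ.≟ 2
  ×-dec + 4 * K ≟ + ξ + + η - lift (α ℕ.+ β) - lift (γ ℕ.+ δ)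

-- Each side determines K: the window through its value at 0, the conditions
-- through their last equation.
window-K : (α β ξ γ δ η : ℕ) → ℤ
window-K α β ξ γ δ η = - (reduced α β ξ (+ 0) + reduced γ δ η (+ 0))

conditions-K : (α β ξ γ δ η : ℕ) → ℤ
conditions-K α β ξ γ δ η = ceil4 (+ ξ + + η - lift (α ℕ.+ β) - lift (γ ℕ.+ δ))

window-forces-K : ∀ {α β ξ γ δ η K} → Window α β ξ γ δ η K → K ≡ window-K α β ξ γ δ η
window-forces-K {α} {β} {ξ} {γ} {δ} {η} {K} window =
  by-difference (isolate (reduced α β ξ (+ 0) + reduced γ δ η (+ 0)) K) (window (s≤s z≤n))
  where
  isolate : ∀ F K → K ≡ ((F + K) - + 0) + (- F)
  isolate = solve-∀

conditions-force-K : ∀ {α β ξ γ δ η K} → Conditions α β ξ γ δ η K → K ≡ conditions-K α β ξ γ δ η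
conditions-force-K {K = K} (_ , _ , _ , _ , _ , _ , _ , balanced) =
  trans (sym (ceil4-exact K)) (cong ceil4 balanced)

Agreement : (α β ξ γ δ η : ℕ) → Set
Agreement α β ξ γ δ η =
    (Window α β ξ γ δ η (window-K α β ξ γ δ η) → Conditions α β ξ γ δ η (window-K α β ξ γ δ η))
  × (Conditions α β ξ γ δ η (conditions-K α β ξ γ δ η) → Window α β ξ γ δ η (conditions-K α β ξ γ δ η))

agreement? : ∀ α β ξ γ δ η → Dec (Agreement α β ξ γ δ η)
agreement? α β ξ γ δ η =
      (window? α β ξ γ δ η _ →-dec conditions? α β ξ γ δ η _)
  ×-dec (conditions? α β ξ γ δ η _ →-dec window? α β ξ γ δ η _)

all-agree : ∀ {α} → α ℕ.< 4 → ∀ {β} → β ℕ.< 4 → ∀ {ξ} → ξ ℕ.< 4 →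
            ∀ {γ} → γ ℕ.< 4 → ∀ {δ} → δ ℕ.< 4 → ∀ {η} → η ℕ.< 4 → Agreement α β ξ γ δ η
all-agree = toWitness {a? = below4 λ α → below4 λ β → below4 λ ξ → below4 λ γ → below4 λ δ → below4 λ η →
                             agreement? α β ξ γ δ η} tt
  where
  below4 : {P : ℕ → Set} → (∀ n → Dec (P n)) → Dec (∀ {n} → n ℕ.< 4 → P n)
  below4 P? = ℕₚ.allUpTo? P? 4

-- For remainders below 4 the two sides agree for every K: each side forces K,
-- and at the forced value the finite check applies.
window⇔conditions : ∀ {α β ξ γ δ η} → α ℕ.< 4 → β ℕ.< 4 → ξ ℕ.< 4 → γ ℕ.< 4 → δ ℕ.< 4 → η ℕ.< 4 →
  ∀ K → Window α β ξ γ δ η K ⇔ Conditions α β ξ γ δ η K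
window⇔conditions {α} {β} {ξ} {γ} {δ} {η} α<4 β<4 ξ<4 γ<4 δ<4 η<4 K = mk⇔ forward backward
  where
  agree : Agreement α β ξ γ δ η
  agree = all-agree α<4 β<4 ξ<4 γ<4 δ<4 η<4

  forward : Window α β ξ γ δ η K → Conditions α β ξ γ δ η K
  forward window =
    subst (Conditions α β ξ γ δ η) (sym K≡) (proj₁ agree (subst (Window α β ξ γ δ η) K≡ window))
    where
    K≡ : K ≡ window-K α β ξ γ δ η
    K≡ = window-forces-K {α} {β} {ξ} {γ} {δ} {η} {K} window

  backward : Conditions α β ξ γ δ η K → Window α β ξ γ δ η K
  backward conditions =
    subst (Window α β ξ γ δ η) (sym K≡) (proj₂ agree (subst (Conditions α β ξ γ δ η) K≡ conditions))
    where
    K≡ : K ≡ conditions-K α β ξ γ δ η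
    K≡ = conditions-force-K conditions

-- Solution ⇔ window ⇔ conditions on the remainders ⇔ conditions (i)–(iii).
corollary5p11 : (s t a b c d : ℤ) → + 0 ≤ s → + 0 ≤ t → + 1 ≤ a → + 1 ≤ b → + 1 ≤ c → + 1 ≤ d →
    IsSolution s t a b c d ⇔
      Σ ℤ (λ κ → Σ ℤ (λ m → κ ≡ + 2 * m + + 1)
        × ((a + b ≡ + 4 * (s + κ) - + 1) ⊎ (a + b ≡ + 4 * (s + κ)) ⊎ (a + b ≡ + 4 * (s + κ) + + 1))
        × ((c + d ≡ + 4 * (t - κ) - + 1) ⊎ (c + d ≡ + 4 * (t - κ)) ⊎ (c + d ≡ + 4 * (t - κ) + + 1))
        × ¬ (+ 4 ∣ a) × ¬ (+ 4 ∣ b) × ¬ (+ 4 ∣ c) × ¬ (+ 4 ∣ d))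
corollary5p11 s t a b c d _ _ _ _ _ _ =
  ⇔-trans (solution⇔window s t a b c d)
  (⇔-trans (window⇔conditions (rem4<4 a) (rem4<4 b) (rem4<4 (offset s a b))
                              (rem4<4 c) (rem4<4 d) (rem4<4 (offset t c d)) _)
           (⇔-sym (goal⇔conditions s t a b c d)))
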